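{- Let $\mathcal{GO}=\langle t,\prec,\phi\rangle$ be a GOMT problem with $\phi$ satisfiable, and let $\langle\mathcal{I},\Delta,\tau\rangle$ be a state in a $\mathcal{GO}$-derivation with $\tau=(\tau_1,\dots,\tau_m)$. Then $\phi\models_{\mathcal{T}}\left(\bigvee_{i=1}^m\tau_i\Leftrightarrow\Delta\right)$, where the empty disjunction (case $m=0$) is $\mathit{False}$.
   Context: Fix a many-sorted first-order theory $\mathcal{T}$ with signature $\Sigma$; interpretations are $\mathcal{T}$-interpretations assigning values to all variables, and $\models$ means $\models_{\mathcal{T}}$ ($\alpha\models\beta$: every $\mathcal{T}$-interpretation satisfying $\alpha$ satisfies $\beta$). A GOMT problem is $\mathcal{GO}=\langle t,\prec,\phi\rangle$: $t$ a $\Sigma$-term of sort $\sigma$, $\prec$ a strict partial order on values of sort $\sigma$ definable in $\mathcal{T}$, $\phi$ a $\Sigma$-formula. $\mathcal{I}$ is $\mathcal{GO}$-consistent if $\mathcal{I}\models\phi$; $\mathcal{I}<_{\mathcal{GO}}\mathcal{I}'$ if both are $\mathcal{GO}$-consistent and $t^{\mathcal{I}}\prec t^{\mathcal{I}'}$. $\textsc{Solve}$ maps a formula to an interpretation satisfying it if satisfiable, else to $\bot$. $\textsc{Better}$ maps each $\mathcal{GO}$-consistent $\mathcal{I}$ to a formula with: for every $\mathcal{GO}$-consistent $\mathcal{I}'$, $\mathcal{I}'\models\textsc{Better}(\mathcal{I})$ iff $\mathcal{I}'<_{\mathcal{GO}}\mathcal{I}$. $\textsc{Top}(s_1,\dots,s_n)=s_1$,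 $\textsc{Pop}(s_1,\dots,s_n)=(s_2,\dots,s_n)$, $\emptyset$ the empty sequence, $\circ$ concatenation. A state is $\langle\mathcal{I},\Delta,\tau\rangle$ (interpretation, formula, finite sequence of formulas). Initial state: $\mathcal{I}_0=\textsc{Solve}(\phi)$, $\Delta_0=\textsc{Better}(\mathcal{I}_0)$, $\tau_0=(\Delta_0)$. Rules (unmentioned components unchanged): F-Split: if $\tau\neq\emptyset$, $\psi=\textsc{Top}(\tau)$, $\phi\models\psi\Leftrightarrow\bigvee_{j=1}^k\psi_j$, $k\ge1$, then $\tau:=(\psi_1,\dots,\psi_k)\circ\textsc{Pop}(\tau)$. F-Sat: if $\tau\neq\emptyset$, $\psi=\textsc{Top}(\tau)$, $\textsc{Solve}(\phi\wedge\psi)=\mathcal{I}'\neq\bot$, $\Delta'=\Delta\wedge\textsc{Better}(\mathcal{I}')$, then $\mathcal{I}:=\mathcal{I}'$, $\Delta:=\Delta'$, $\tau:=(\Delta')$. F-Close: if $\tau\neq\emptyset$, $\psi=\textsc{Top}(\tau)$, $\textsc{Solve}(\phi\wedge\psi)=\bot$, then $\Delta:=\Delta\wedge\neg\psi$, $\tau:=\textsc{Pop}(\tau)$. A rule applies if its premises hold and the resulting state differs. A $\mathcal{GO}$-derivation is a sequence of states starting at the initial state, each obtained from the previous by one rule. -}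

module Defs where

open import Data.List using (List; []; _∷_; foldr; _++_)
open import Data.Maybe using (Maybe; just; nothing)
open import Data.Product using (Σ; ∃; _×_; _,_)
open import Data.Sum using (_⊎_)
open import Relation.Nullary using (¬_)
open import Relation.Binary using (Rel; IsStrictPartialOrder)
open import Relation.Binary.PropositionalEquality using (_≡_)
open import Function.Bundles using (_⇔_)

-- A fixed first-order theory T, presented semantically:
-- Interp  = the T-interpretations (assigning values to all variables),
-- Formula = the Σ-formulas, _⊨_ = satisfaction, with the standard
-- semantic clauses for the propositional connectives used below.
record Theory : Set₁ where
  infixr 6 _∧ᶠ_
  infixr 5 _∨ᶠ_
  infix 4 _⇔ᶠ_
  infix 3 _⊨_
  field
    Interp  : Set
    Formula : Set
    _⊨_     : Interp → Formula → Set
    False   : Formula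
    _∧ᶠ_ _∨ᶠ_ _⇔ᶠ_ : Formula → Formula → Formula
    ¬ᶠ_     : Formula → Formula
    ⊨-False : ∀ I → ¬ (I ⊨ False)
    ⊨-∧     : ∀ I a b → (I ⊨ a ∧ᶠ b) ⇔ (I ⊨ a × I ⊨ b)
    ⊨-∨     : ∀ I a b → (I ⊨ a ∨ᶠ b) ⇔ (I ⊨ a ⊎ I ⊨ b)
    ⊨-¬     : ∀ I a → (I ⊨ ¬ᶠ a) ⇔ (¬ (I ⊨ a))
    ⊨-⇔     : ∀ I a b → (I ⊨ a ⇔ᶠ b) ⇔ ((I ⊨ a) ⇔ (I ⊨ b))

  _⊨ᵀ_ : Formula → Formula → Set
  α ⊨ᵀ β = ∀ I → I ⊨ α → I ⊨ β

  Satisfiable : Formula → Set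
  Satisfiable α = ∃ λ I → I ⊨ α

  ⋁ : List Formula → Formula
  ⋁ = foldr _∨ᶠ_ False

record GOMT (T : Theory) : Set₁ where
  open Theory T
  field
    Val   : Set                    -- values of the sort σ of t
    _≺_   : Rel Val _
    ≺-spo : IsStrictPartialOrder _≡_ _≺_
    t     : Interp → Val
    φ     : Formula

  GO-consistent : Interp → Set
  GO-consistent I = I ⊨ φ

  _<GO_ : Interp → Interp → Set
  I <GO I' = GO-consistent I × GO-consistent I' × (t I ≺ t I')

record Oracles (T : Theory) (G : GOMT T) : Set₁ where
  open Theory T
  open GOMT G
  field
    Solve       : Formula → Maybe Interp
    Solve-sound : ∀ α I → Solve α ≡ just I → I ⊨ α
    Solve-unsat : ∀ α → Solve α ≡ nothing → ¬ Satisfiable α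
    Better      : Interp → Formula
    Better-spec : ∀ I → GO-consistent I → ∀ I' → GO-consistent I' →
                  (I' ⊨ Better I) ⇔ (I' <GO I)

module Calculus {T : Theory} (G : GOMT T) (O : Oracles T G) where
  open Theory T
  open GOMT G
  open Oracles O

  record State : Set where
    constructor ⟨_,_,_⟩
    field
      I : Interp
      Δ : Formula
      τ : List Formula

  -- one rule application (premises hold and the state changes)
  data _⟶_ : State → State → Set where
    F-Split : ∀ {I Δ ψ rest} (ψ₁ : Formula) (ψs : List Formula) →
              φ ⊨ᵀ (ψ ⇔ᶠ ⋁ (ψ₁ ∷ ψs)) →
              ¬ (⟨ I , Δ , ψ ∷ rest ⟩ ≡ ⟨ I , Δ , (ψ₁ ∷ ψs) ++ rest ⟩) →
              ⟨ I , Δ , ψ ∷ rest ⟩ ⟶ ⟨ I , Δ , (ψ₁ ∷ ψs) ++ rest ⟩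
    F-Sat   : ∀ {I Δ ψ rest} (I' : Interp) →
              Solve (φ ∧ᶠ ψ) ≡ just I' →
              ¬ (⟨ I , Δ , ψ ∷ rest ⟩ ≡ ⟨ I' , Δ ∧ᶠ Better I' , (Δ ∧ᶠ Better I') ∷ [] ⟩) →
              ⟨ I , Δ , ψ ∷ rest ⟩ ⟶ ⟨ I' , Δ ∧ᶠ Better I' , (Δ ∧ᶠ Better I') ∷ [] ⟩
    F-Close : ∀ {I Δ ψ rest} →
              Solve (φ ∧ᶠ ψ) ≡ nothing →
              ¬ (⟨ I , Δ , ψ ∷ rest ⟩ ≡ ⟨ I , Δ ∧ᶠ ¬ᶠ ψ , rest ⟩) →
              ⟨ I , Δ , ψ ∷ rest ⟩ ⟶ ⟨ I , Δ ∧ᶠ ¬ᶠ ψ , rest ⟩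

  data InDerivation : State → Set where
    initial : ∀ {I₀} → Solve φ ≡ just I₀ →
              InDerivation ⟨ I₀ , Better I₀ , Better I₀ ∷ [] ⟩
    step    : ∀ {s s'} → InDerivation s → s ⟶ s' → InDerivation s'

module Submission where

-- The invariant "φ ⊨ ⋁ τ ⇔ Δ" holds initially and after F-Sat because then
-- τ = (Δ). F-Split replaces the top ψ of τ by disjuncts that φ makes
-- equivalent to ψ, so ⋁ τ does not change modulo φ. F-Close moves ψ from τ
-- into Δ as ¬ψ; this is harmless because ψ has no model together with φ.

open import Defs
open import Data.Empty using (⊥-elim)
open import Data.List using ([]; _∷_; _++_)
open import Data.Product using (_×_; _,_; proj₁)
open import Data.Product.Function.NonDependent.Propositional using (_×-⇔_)
open import Data.Sum using (_⊎_; inj₁; inj₂; [_,_])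
open import Data.Sum.Algebra using (⊎-assoc)
open import Data.Sum.Function.Propositional using (_⊎-⇔_)
open import Function using (id)
open import Function.Bundles using (_⇔_; mk⇔; Equivalence)
open import Function.Construct.Identity using (⇔-id)
open import Function.Properties.Equivalence using (⇔-setoid; sym)
open import Function.Properties.Inverse using (↔⇒⇔)
open import Level using (0ℓ)
open import Relation.Nullary using (¬_)
open import Relation.Binary.Reasoning.Setoid (⇔-setoid 0ℓ)

⊎-falseˡ : ∀ {A B : Set} → ¬ A → (A ⊎ B) ⇔ B
⊎-falseˡ ¬a = mk⇔ [ (λ a → ⊥-elim (¬a a)) , id ] inj₂

⊎-falseʳ : ∀ {A B : Set} → ¬ B → (A ⊎ B) ⇔ A
⊎-falseʳ ¬b = mk⇔ [ id , (λ b → ⊥-elim (¬b b)) ] inj₁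

×-trueʳ : ∀ {A B : Set} → B → (A × B) ⇔ A
×-trueʳ b = mk⇔ proj₁ (_, b)

module Disjunction (T : Theory) where
  open Theory T

  ⊨-⋁-singleton : ∀ I a → (I ⊨ ⋁ (a ∷ [])) ⇔ (I ⊨ a)
  ⊨-⋁-singleton I a = begin
    (I ⊨ a ∨ᶠ False)      ≈⟨ ⊨-∨ I a False ⟩
    (I ⊨ a ⊎ I ⊨ False)   ≈⟨ ⊎-falseʳ (⊨-False I) ⟩
    (I ⊨ a)               ∎

  ⊨-⋁-++ : ∀ I l r → (I ⊨ ⋁ (l ++ r)) ⇔ (I ⊨ ⋁ l ⊎ I ⊨ ⋁ r)
  ⊨-⋁-++ I []      r = sym (⊎-falseˡ (⊨-False I))
  ⊨-⋁-++ I (a ∷ l) r = begin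
    (I ⊨ a ∨ᶠ ⋁ (l ++ r))             ≈⟨ ⊨-∨ I a (⋁ (l ++ r)) ⟩
    (I ⊨ a ⊎ I ⊨ ⋁ (l ++ r))          ≈⟨ ⇔-id _ ⊎-⇔ ⊨-⋁-++ I l r ⟩
    (I ⊨ a ⊎ (I ⊨ ⋁ l ⊎ I ⊨ ⋁ r))     ≈⟨ ↔⇒⇔ (⊎-assoc 0ℓ (I ⊨ a) _ _) ⟨
    ((I ⊨ a ⊎ I ⊨ ⋁ l) ⊎ I ⊨ ⋁ r)     ≈⟨ ⊨-∨ I a (⋁ l) ⊎-⇔ ⇔-id _ ⟨
    (I ⊨ a ∨ᶠ ⋁ l ⊎ I ⊨ ⋁ r)          ∎

module Invariant {T : Theory} (G : GOMT T) (O : Oracles T G) where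
  open Theory T
  open GOMT G
  open Oracles O
  open Calculus G O
  open Disjunction T

  ⋁τ⇔Δ : State → Set
  ⋁τ⇔Δ ⟨ _ , Δ , τ ⟩ = ∀ I → I ⊨ φ → (I ⊨ ⋁ τ) ⇔ (I ⊨ Δ)

  ⋁τ⇔Δ-initial : ∀ {I₀} → ⋁τ⇔Δ ⟨ I₀ , Better I₀ , Better I₀ ∷ [] ⟩
  ⋁τ⇔Δ-initial {I₀} I _ = ⊨-⋁-singleton I (Better I₀)

  ⋁τ⇔Δ-step : ∀ {s s'} → ⋁τ⇔Δ s → s ⟶ s' → ⋁τ⇔Δ s'
  ⋁τ⇔Δ-step {s' = ⟨ _ , Δ' , _ ⟩} _ (F-Sat _ _ _) I _ = ⊨-⋁-singleton I Δ'
  ⋁τ⇔Δ-step {⟨ _ , Δ , ψ ∷ rest ⟩} inv (F-Split ψ₁ ψs φ⊨ψ⇔ψs _) I I⊨φ = begin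
    (I ⊨ ⋁ ((ψ₁ ∷ ψs) ++ rest))             ≈⟨ ⊨-⋁-++ I (ψ₁ ∷ ψs) rest ⟩
    (I ⊨ ⋁ (ψ₁ ∷ ψs) ⊎ I ⊨ ⋁ rest)          ≈⟨ ψ⇔ψs ⊎-⇔ ⇔-id _ ⟨
    (I ⊨ ψ ⊎ I ⊨ ⋁ rest)                    ≈⟨ ⊨-∨ I ψ (⋁ rest) ⟨
    (I ⊨ ⋁ (ψ ∷ rest))                      ≈⟨ inv I I⊨φ ⟩
    (I ⊨ Δ)                                 ∎
    where
    ψ⇔ψs : (I ⊨ ψ) ⇔ (I ⊨ ⋁ (ψ₁ ∷ ψs))
    ψ⇔ψs = Equivalence.to (⊨-⇔ I ψ _) (φ⊨ψ⇔ψs I I⊨φ)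
  ⋁τ⇔Δ-step {⟨ _ , Δ , ψ ∷ rest ⟩} inv (F-Close unsat _) I I⊨φ = begin
    (I ⊨ ⋁ rest)                            ≈⟨ ⊎-falseˡ I⊭ψ ⟨
    (I ⊨ ψ ⊎ I ⊨ ⋁ rest)                    ≈⟨ ⊨-∨ I ψ (⋁ rest) ⟨
    (I ⊨ ⋁ (ψ ∷ rest))                      ≈⟨ inv I I⊨φ ⟩
    (I ⊨ Δ)                                 ≈⟨ ×-trueʳ I⊭ψ ⟨
    (I ⊨ Δ × ¬ (I ⊨ ψ))                     ≈⟨ ⇔-id (I ⊨ Δ) ×-⇔ ⊨-¬ I ψ ⟨
    (I ⊨ Δ × I ⊨ ¬ᶠ ψ)                      ≈⟨ ⊨-∧ I Δ (¬ᶠ ψ) ⟨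
    (I ⊨ Δ ∧ᶠ ¬ᶠ ψ)                         ∎
    where
    I⊭ψ : ¬ (I ⊨ ψ)
    I⊭ψ I⊨ψ = Solve-unsat (φ ∧ᶠ ψ) unsat
                (I , Equivalence.from (⊨-∧ I φ ψ) (I⊨φ , I⊨ψ))

  ⋁τ⇔Δ-derivation : ∀ {s} → InDerivation s → ⋁τ⇔Δ s
  ⋁τ⇔Δ-derivation (initial _) = ⋁τ⇔Δ-initial
  ⋁τ⇔Δ-derivation (step d s⟶s') = ⋁τ⇔Δ-step (⋁τ⇔Δ-derivation d) s⟶s'

lemma4 : (T : Theory) (G : GOMT T) (O : Oracles T G) →
         Theory.Satisfiable T (GOMT.φ G) →
         (s : Calculus.State G O) → Calculus.InDerivation G O s →
         Theory._⊨ᵀ_ T (GOMT.φ G)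
           (Theory._⇔ᶠ_ T (Theory.⋁ T (Calculus.State.τ s)) (Calculus.State.Δ s))
lemma4 T G O _ s d I I⊨φ =
  Equivalence.from (⊨-⇔ I _ _) (⋁τ⇔Δ-derivation d I I⊨φ)
  where
  open Theory T
  open Invariant G O
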